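{- Let $\mathcal{K}_1=(K_1,\Gamma_1,k_1,v_1,res_1)$ and $\mathcal{K}_2=(K_2,\Gamma_2,k_2,v_2,res_2)$ be $\mathfrak{L}^{*}_{vf}$-structures with $\mathcal{K}_1\subseteq\mathcal{K}_2$, and let $\widetilde{\mathcal{K}_1},\widetilde{\mathcal{K}_2}$ be the corresponding $\mathfrak{L}^{**}_{vf}$-structures. Then $\mathcal{K}_1\preceq\mathcal{K}_2$ in $\mathfrak{L}^{*}_{vf}$ if and only if $\widetilde{\mathcal{K}_1}\preceq\widetilde{\mathcal{K}_2}$ in $\mathfrak{L}^{**}_{vf}$.
   Context: Fix an index set $I\subseteq\mathbb{N}$. $\mathfrak{L}^{*}_{vf}$ is the three-sorted language with a field sort in the language of rings $\{0,1,+,\cdot\}$, a value group sort in the language $\{0,+,-,\leq\}$ expanded by unary predicates $P_{i,j}$ ($i\in I$, $j\in\{0,1\}$; in the intended interpretation $P_{i,j}$ is the coset $j1_i+H_i$ of a convex subgroup $H_i$), a residue field sort in the language of rings, and function symbols $v$ (valuation, field sort to value group sort) and $res$ (residue map, field sort to residue sort). $\mathfrak{L}^{**}_{vf}$ is the three-sorted language with the field sort in the language of rings expanded by unary predicates $A_{i,j}$ ($i\in I$, $j\in\{0,1\}$), the value group sort in $\{0,+,-,\leq\}$ only, the residue sort in the language of rings, and $v,res$. Given an $\mathfrak{L}^{*}_{vf}$-structure $(K,\Gamma,k,v,res)$, the corresponding $\mathfrak{L}^{**}_{vf}$-structure has the same sorts and maps, forgets the $P_{i,j}$ on $\Gamma$,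 and interprets $A_{i,j}^K=\{a\in K: v(a)\in P_{i,j}^{\Gamma}\}$. -}

module Defs where

open import Data.Nat using (ℕ)
open import Data.Fin using (Fin)
open import Data.List using (List; []; _∷_)
open import Data.List.Relation.Unary.All as All using (All; []; _∷_)
open import Data.List.Membership.Propositional using (_∈_)
open import Data.Product using (Σ; ∃; _×_; _,_)
open import Data.Empty using (⊥)
open import Data.Unit using (⊤)
open import Data.Sum using (_⊎_)
open import Relation.Binary.PropositionalEquality using (_≡_)
open import Function.Bundles using (_⇔_)

record Signature : Set₁ where
  field
    Sort  : Set
    Fun   : Set
    fargs : Fun → List Sort
    fres  : Fun → Sort
    Rel   : Set
    rargs : Rel → List Sort

module _ (L : Signature) where
  open Signature L

  mutual
    data Term (Γ : List Sort) : Sort → Set where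
      var : ∀ {s} → s ∈ Γ → Term Γ s
      app : (f : Fun) → Terms Γ (fargs f) → Term Γ (fres f)

    data Terms (Γ : List Sort) : List Sort → Set where
      []  : Terms Γ []
      _∷_ : ∀ {s ss} → Term Γ s → Terms Γ ss → Terms Γ (s ∷ ss)

  data Formula (Γ : List Sort) : Set where
    tt   : Formula Γ
    ff   : Formula Γ
    eq   : ∀ {s} → Term Γ s → Term Γ s → Formula Γ
    atom : (r : Rel) → Terms Γ (rargs r) → Formula Γ
    neg  : Formula Γ → Formula Γ
    and  : Formula Γ → Formula Γ → Formula Γ
    or   : Formula Γ → Formula Γ → Formula Γ
    imp  : Formula Γ → Formula Γ → Formula Γ
    ex   : (s : Sort) → Formula (s ∷ Γ) → Formula Γ
    all  : (s : Sort) → Formula (s ∷ Γ) → Formula Γ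

  record Structure : Set₁ where
    field
      Car : Sort → Set
      fun : (f : Fun) → All Car (fargs f) → Car (fres f)
      rel : (r : Rel) → All Car (rargs r) → Set

module _ {L : Signature} (M : Structure L) where
  open Signature L
  open Structure M

  mutual
    evalT : ∀ {Γ s} → All Car Γ → Term L Γ s → Car s
    evalT ρ (var x)    = All.lookup ρ x
    evalT ρ (app f ts) = fun f (evalTs ρ ts)

    evalTs : ∀ {Γ ss} → All Car Γ → Terms L Γ ss → All Car ss
    evalTs ρ []       = []
    evalTs ρ (t ∷ ts) = evalT ρ t ∷ evalTs ρ ts

  Sat : ∀ {Γ} → All Car Γ → Formula L Γ → Set
  Sat ρ tt          = ⊤
  Sat ρ ff          = ⊥
  Sat ρ (eq t u)    = evalT ρ t ≡ evalT ρ u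
  Sat ρ (atom r ts) = rel r (evalTs ρ ts)
  Sat ρ (neg φ)     = Sat ρ φ → ⊥
  Sat ρ (and φ ψ)   = Sat ρ φ × Sat ρ ψ
  Sat ρ (or φ ψ)    = Sat ρ φ ⊎ Sat ρ ψ
  Sat ρ (imp φ ψ)   = Sat ρ φ → Sat ρ ψ
  Sat ρ (ex s φ)    = Σ (Car s) λ a → Sat (a ∷ ρ) φ
  Sat ρ (all s φ)   = (a : Car s) → Sat (a ∷ ρ) φ

module _ {L : Signature} (M N : Structure L) where
  open Signature L
  private
    module M = Structure M
    module N = Structure N

  record IsSubstructure (ι : ∀ {s} → M.Car s → N.Car s) : Set where
    field
      injective : ∀ {s} {a b : M.Car s} → ι a ≡ ι b → a ≡ b
      pres-fun  : (f : Fun) (as : All M.Car (fargs f)) →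
                  ι (M.fun f as) ≡ N.fun f (All.map ι as)
      pres-rel  : (r : Rel) (as : All M.Car (rargs r)) →
                  M.rel r as ⇔ N.rel r (All.map ι as)

  IsElementary : (ι : ∀ {s} → M.Car s → N.Car s) → Set
  IsElementary ι = ∀ {Γ} (φ : Formula L Γ) (ρ : All M.Car Γ) →
                   Sat M ρ φ ⇔ Sat N (All.map ι ρ) φ

data VFSort : Set where
  fld grp rsd : VFSort

data VFFun : Set where
  fzero fone fadd fmul : VFFun
  gzero gadd gminus    : VFFun
  rzero rone radd rmul : VFFun
  val res              : VFFun

vfargs : VFFun → List VFSort
vfargs fzero  = []
vfargs fone   = []
vfargs fadd   = fld ∷ fld ∷ []
vfargs fmul   = fld ∷ fld ∷ []
vfargs gzero  = []
vfargs gadd   = grp ∷ grp ∷ []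
vfargs gminus = grp ∷ grp ∷ []
vfargs rzero  = []
vfargs rone   = []
vfargs radd   = rsd ∷ rsd ∷ []
vfargs rmul   = rsd ∷ rsd ∷ []
vfargs val    = fld ∷ []
vfargs res    = fld ∷ []

vfres : VFFun → VFSort
vfres fzero  = fld
vfres fone   = fld
vfres fadd   = fld
vfres fmul   = fld
vfres gzero  = grp
vfres gadd   = grp
vfres gminus = grp
vfres rzero  = rsd
vfres rone   = rsd
vfres radd   = rsd
vfres rmul   = rsd
vfres val    = grp
vfres res    = rsd

data RelStar (I : ℕ → Set) : Set where
  gle : RelStar I
  P   : Σ ℕ I → Fin 2 → RelStar I

rargsStar : ∀ {I} → RelStar I → List VFSort
rargsStar gle     = grp ∷ grp ∷ []
rargsStar (P i j) = grp ∷ []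

data RelStarStar (I : ℕ → Set) : Set where
  gle : RelStarStar I
  A   : Σ ℕ I → Fin 2 → RelStarStar I

rargsStarStar : ∀ {I} → RelStarStar I → List VFSort
rargsStarStar gle     = grp ∷ grp ∷ []
rargsStarStar (A i j) = fld ∷ []

Lstar : (I : ℕ → Set) → Signature
Lstar I = record { Sort = VFSort ; Fun = VFFun ; fargs = vfargs ; fres = vfres
                 ; Rel = RelStar I ; rargs = rargsStar }

Lstarstar : (I : ℕ → Set) → Signature
Lstarstar I = record { Sort = VFSort ; Fun = VFFun ; fargs = vfargs ; fres = vfres
                     ; Rel = RelStarStar I ; rargs = rargsStarStar }

tilde : ∀ {I} → Structure (Lstar I) → Structure (Lstarstar I)
tilde {I} M = record { Car = Car ; fun = fun ; rel = rel' }
  where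
    open Structure M
    rel' : (r : RelStarStar I) → All Car (rargsStarStar r) → Set
    rel' gle     as       = rel gle as
    rel' (A i j) (a ∷ []) = rel (P i j) (fun val (a ∷ []) ∷ [])

-- the valuation map v : K → Γ is onto Γ (true in every valued field)
ValSurjective : ∀ {I} → Structure (Lstar I) → Set
ValSurjective M = ∀ (γ : Car grp) → ∃ λ (a : Car fld) → fun val (a ∷ []) ≡ γ
  where open Structure M

-- The predicates P_{i,j} of L*_vf and A_{i,j} of L**_vf are interdefinable:
-- A_{i,j}(x) ↔ P_{i,j}(v x), and, because v is onto Γ,
-- P_{i,j}(γ) ↔ ∃ x. v x = γ ∧ A_{i,j}(x).
-- Replacing atoms accordingly translates formulas of either language into
-- the other, uniformly in the structure, so an embedding that is elementary
-- for one language is elementary for the other.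
module Submission where

open import Defs
open import Data.Nat using (ℕ)
open import Data.List using (List; []; _∷_)
open import Data.List.Relation.Unary.All as All using (All; []; _∷_)
open import Data.List.Relation.Unary.Any using (here; there)
open import Data.Product using (Σ; _×_; _,_)
import Data.Product.Function.Dependent.Propositional as Σ
open import Data.Product.Function.NonDependent.Propositional using (_×-⇔_)
open import Data.Sum.Function.Propositional using (_⊎-⇔_)
open import Function.Bundles using (_⇔_; mk⇔; Equivalence)
open import Function.Properties.Equivalence using ()
  renaming (refl to ⇔-refl; sym to ⇔-sym; trans to ⇔-trans)
open import Function.Related.Propositional using (equivalence)
open import Function.Related.TypeIsomorphisms using (→-cong-⇔; ¬-cong-⇔)
open import Relation.Binary.PropositionalEquality using (_≡_; refl; cong; cong₂; subst; sym; trans)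

∀-cong-⇔ : ∀ {A : Set} {P Q : A → Set} →
           (∀ a → P a ⇔ Q a) → ((a : A) → P a) ⇔ ((a : A) → Q a)
∀-cong-⇔ P⇔Q = mk⇔ (λ p a → Equivalence.to (P⇔Q a) (p a))
                   (λ q a → Equivalence.from (P⇔Q a) (q a))

module _ {L : Signature} where

  mutual
    weaken : ∀ {Γ s s′} → Term L Γ s → Term L (s′ ∷ Γ) s
    weaken (var x)    = var (there x)
    weaken (app f ts) = app f (weakens ts)

    weakens : ∀ {Γ ss s′} → Terms L Γ ss → Terms L (s′ ∷ Γ) ss
    weakens []       = []
    weakens (t ∷ ts) = weaken t ∷ weakens ts

  module _ (M : Structure L) where
    open Structure M

    mutual
      evalT-weaken : ∀ {Γ s s′} (a : Car s′) (ρ : All Car Γ) (t : Term L Γ s) →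
                     evalT M (a ∷ ρ) (weaken t) ≡ evalT M ρ t
      evalT-weaken a ρ (var x)    = refl
      evalT-weaken a ρ (app f ts) = cong (fun f) (evalTs-weaken a ρ ts)

      evalTs-weaken : ∀ {Γ ss s′} (a : Car s′) (ρ : All Car Γ) (ts : Terms L Γ ss) →
                      evalTs M (a ∷ ρ) (weakens ts) ≡ evalTs M ρ ts
      evalTs-weaken a ρ []       = refl
      evalTs-weaken a ρ (t ∷ ts) = cong₂ _∷_ (evalT-weaken a ρ t) (evalTs-weaken a ρ ts)


-- L*_vf and L**_vf are both of this form: they share sorts and function
-- symbols and differ only in their relation symbols.
vfSignature : (R : Set) → (R → List VFSort) → Signature
vfSignature R ra = record
  { Sort = VFSort ; Fun = VFFun ; fargs = vfargs ; fres = vfres ; Rel = R ; rargs = ra }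

module _ {R R′ : Set} {ra : R → List VFSort} {ra′ : R′ → List VFSort} where
  private
    L  = vfSignature R ra
    L′ = vfSignature R′ ra′

  withRel : (M : Structure L) → ((r : R′) → All (Structure.Car M) (ra′ r) → Set) →
            Structure L′
  withRel M rel′ = record { Car = Structure.Car M ; fun = Structure.fun M ; rel = rel′ }

  mutual
    relabel : ∀ {Γ s} → Term L Γ s → Term L′ Γ s
    relabel (var x)    = var x
    relabel (app f ts) = app f (relabels ts)

    relabels : ∀ {Γ ss} → Terms L Γ ss → Terms L′ Γ ss
    relabels []       = []
    relabels (t ∷ ts) = relabel t ∷ relabels ts

  module _ (M : Structure L) (rel′ : (r : R′) → All (Structure.Car M) (ra′ r) → Set) where
    open Structure M

    mutual
      evalT-relabel : ∀ {Γ s} (ρ : All Car Γ) (t : Term L Γ s) →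
                      evalT (withRel M rel′) ρ (relabel t) ≡ evalT M ρ t
      evalT-relabel ρ (var x)    = refl
      evalT-relabel ρ (app f ts) = cong (fun f) (evalTs-relabel ρ ts)

      evalTs-relabel : ∀ {Γ ss} (ρ : All Car Γ) (ts : Terms L Γ ss) →
                       evalTs (withRel M rel′) ρ (relabels ts) ≡ evalTs M ρ ts
      evalTs-relabel ρ []       = refl
      evalTs-relabel ρ (t ∷ ts) = cong₂ _∷_ (evalT-relabel ρ t) (evalTs-relabel ρ ts)

  AtomTranslation : Set
  AtomTranslation = ∀ {Γ} (r : R) → Terms L Γ (ra r) → Formula L′ Γ

  translate : AtomTranslation → ∀ {Γ} → Formula L Γ → Formula L′ Γ
  translate α tt          = tt
  translate α ff          = ff
  translate α (eq t u)    = eq (relabel t) (relabel u)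
  translate α (atom r ts) = α r ts
  translate α (neg φ)     = neg (translate α φ)
  translate α (and φ ψ)   = and (translate α φ) (translate α ψ)
  translate α (or φ ψ)    = or (translate α φ) (translate α ψ)
  translate α (imp φ ψ)   = imp (translate α φ) (translate α ψ)
  translate α (ex s φ)    = ex s (translate α φ)
  translate α (all s φ)   = all s (translate α φ)

  module _ (M : Structure L) (rel′ : (r : R′) → All (Structure.Car M) (ra′ r) → Set) where
    open Structure M

    DefinesAtoms : AtomTranslation → Set
    DefinesAtoms α = ∀ {Γ} (r : R) (ts : Terms L Γ (ra r)) (ρ : All Car Γ) →
                     rel r (evalTs M ρ ts) ⇔ Sat (withRel M rel′) ρ (α r ts)

    sat-translate : {α : AtomTranslation} → DefinesAtoms α →
                    ∀ {Γ} (φ : Formula L Γ) (ρ : All Car Γ) →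
                    Sat M ρ φ ⇔ Sat (withRel M rel′) ρ (translate α φ)
    sat-translate α-ok tt ρ = ⇔-refl
    sat-translate α-ok ff ρ = ⇔-refl
    sat-translate α-ok (eq t u) ρ
      rewrite evalT-relabel M rel′ ρ t | evalT-relabel M rel′ ρ u = ⇔-refl
    sat-translate α-ok (atom r ts) ρ = α-ok r ts ρ
    sat-translate α-ok (neg φ) ρ = ¬-cong-⇔ (sat-translate α-ok φ ρ)
    sat-translate α-ok (and φ ψ) ρ = sat-translate α-ok φ ρ ×-⇔ sat-translate α-ok ψ ρ
    sat-translate α-ok (or φ ψ) ρ = sat-translate α-ok φ ρ ⊎-⇔ sat-translate α-ok ψ ρ
    sat-translate α-ok (imp φ ψ) ρ = →-cong-⇔ (sat-translate α-ok φ ρ) (sat-translate α-ok ψ ρ)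
    sat-translate α-ok (ex s φ) ρ =
      Σ.congˡ {k = equivalence} λ {a} → sat-translate α-ok φ (a ∷ ρ)
    sat-translate α-ok (all s φ) ρ = ∀-cong-⇔ λ a → sat-translate α-ok φ (a ∷ ρ)

  elementary-reflect : ∀ (α : AtomTranslation) {M N : Structure L}
    {relM : (r : R′) → All (Structure.Car M) (ra′ r) → Set}
    {relN : (r : R′) → All (Structure.Car N) (ra′ r) → Set}
    (ι : ∀ {s} → Structure.Car M s → Structure.Car N s) →
    DefinesAtoms M relM α → DefinesAtoms N relN α →
    IsElementary (withRel M relM) (withRel N relN) ι → IsElementary M N ι
  elementary-reflect α {relM = relM} {relN} ι α-okM α-okN elem φ ρ =
    ⇔-trans (sat-translate _ relM α-okM φ ρ)
      (⇔-trans (elem (translate α φ) ρ) (⇔-sym (sat-translate _ relN α-okN φ (All.map ι ρ))))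

⇔-∃-preimage : ∀ {A B : Set} (f : A → B) → (∀ b → Σ A λ a → f a ≡ b) →
               (Q : B → Set) (b : B) → Q b ⇔ Σ A λ a → f a ≡ b × Q (f a)
⇔-∃-preimage f f-onto Q b with f-onto b
... | a , refl = mk⇔ (λ q → a , refl , q) λ { (_ , fa′≡fa , q) → subst Q fa′≡fa q }

module _ {I : ℕ → Set} where

  A-via-P : AtomTranslation {ra = rargsStarStar {I}} {ra′ = rargsStar {I}}
  A-via-P gle     ts       = atom gle (relabels ts)
  A-via-P (A i j) (t ∷ []) = atom (P i j) (app val (relabel t ∷ []) ∷ [])

  P-via-A : AtomTranslation {ra = rargsStar {I}} {ra′ = rargsStarStar {I}}
  P-via-A gle     ts       = atom gle (relabels ts)
  P-via-A (P i j) (t ∷ []) =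
    ex fld (and (eq (app val (x ∷ [])) (weaken (relabel t))) (atom (A i j) (x ∷ [])))
    where x = var (here refl)

  -- By record η, withRel (tilde K) rel is K and withRel K (Structure.rel (tilde K))
  -- is tilde K, so these instantiate elementary-reflect in both directions.
  module _ (K : Structure (Lstar I)) where
    open Structure K

    defines-A-via-P : DefinesAtoms (tilde K) rel A-via-P
    defines-A-via-P gle ts ρ
      rewrite evalTs-relabel (tilde K) rel ρ ts = ⇔-refl
    defines-A-via-P (A i j) (t ∷ []) ρ
      rewrite evalT-relabel (tilde K) rel ρ t = ⇔-refl

    defines-P-via-A : ValSurjective K → DefinesAtoms K (Structure.rel (tilde K)) P-via-A
    defines-P-via-A v-onto gle ts ρ
      rewrite evalTs-relabel K (Structure.rel (tilde K)) ρ ts = ⇔-refl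
    defines-P-via-A v-onto (P i j) (t ∷ []) ρ =
      ⇔-trans (⇔-∃-preimage v v-onto (λ γ → rel (P i j) (γ ∷ [])) (evalT K ρ t))
        (Σ.congˡ {k = equivalence} λ {a} → value-equation a ×-⇔ ⇔-refl)
      where
        v : Car fld → Car grp
        v a = fun val (a ∷ [])

        value-equation : ∀ a →
          (v a ≡ evalT K ρ t) ⇔
          (v a ≡ evalT (tilde K) (a ∷ ρ) (weaken (relabel t)))
        value-equation a = subst (λ γ → (v a ≡ evalT K ρ t) ⇔ (v a ≡ γ)) (sym t-value) ⇔-refl
          where
            t-value : evalT (tilde K) (a ∷ ρ) (weaken (relabel t)) ≡ evalT K ρ t
            t-value = trans (evalT-weaken (tilde K) a ρ (relabel t))
                            (evalT-relabel K (Structure.rel (tilde K)) ρ t)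

corollary4p3 : (I : ℕ → Set) (K₁ K₂ : Structure (Lstar I))
    (ι : ∀ {s} → Structure.Car K₁ s → Structure.Car K₂ s) →
    ValSurjective K₁ → ValSurjective K₂ →
    IsSubstructure K₁ K₂ ι →
    IsElementary K₁ K₂ ι ⇔ IsElementary (tilde K₁) (tilde K₂) ι
corollary4p3 I K₁ K₂ ι v₁-onto v₂-onto _ = mk⇔
  (elementary-reflect A-via-P ι (defines-A-via-P K₁) (defines-A-via-P K₂))
  (elementary-reflect P-via-A ι (defines-P-via-A K₁ v₁-onto) (defines-P-via-A K₂ v₂-onto))
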